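{- Let $V$ be a set of propositional variables, let $n \leq 3$, and let $\Gamma,\Delta \subseteq \mathcal{L}^{\{1,\ldots,n\}}_V$ be such that $(\Gamma,\Delta)$ is inseparable, $\Gamma$ is $(Ag(\Gamma),|\Gamma|)$-maxiconsistent and $\Delta$ is $(Ag(\Delta),|\Delta|)$-maxiconsistent. Suppose $\Diamond[j_1]A_1,\ldots,\Diamond[j_r]A_r \in \Gamma$ and $\Diamond[i_1]B_1,\ldots,\Diamond[i_s]B_s \in \Delta$, where $j_1,\ldots,j_r \in Ag(\Gamma)$ are pairwise different and $i_1,\ldots,i_s \in Ag(\Delta)$ are pairwise different. Then the pair $$(\Gamma^\Box \cup \{[j_1]A_1,\ldots,[j_r]A_r\},\ \Delta^\Box \cup \{[i_1]B_1,\ldots,[i_s]B_s\})$$ is inseparable.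
   Context: $\mathcal{L}^{Ag}_V$ is the set of stit formulas given by $A ::= p \mid A \to A \mid \bot \mid \Box A \mid [j]A$ with $p \in V$, $j \in Ag$ (other Boolean connectives defined as usual; $\Diamond A := \neg\Box\neg A$). $\vdash A$ means derivability in the axiom system $\mathbb{S}$ with axioms: all classical propositional tautologies; S5 axioms for $\Box$ and each $[j]$; $\Box A \to [j]A$; and $(\Diamond[j_1]A_1 \wedge\dots\wedge \Diamond[j_k]A_k) \to \Diamond([j_1]A_1\wedge\dots\wedge[j_k]A_k)$ for pairwise distinct $j_1,\dots,j_k$; rules: modus ponens and necessitation for $\Box$. For a set $\Gamma$, $\Gamma\vdash A$ means $\vdash (A_1\wedge\dots\wedge A_r)\to A$ for some $A_1,\dots,A_r\in\Gamma$; $\Gamma$ is consistent iff not $\Gamma\vdash\bot$; $\Gamma$ is $(Ag',V')$-maxiconsistent iff $\Gamma\subseteq\mathcal{L}^{Ag'}_{V'}$ is consistent and no consistent subset of $\mathcal{L}^{Ag'}_{V'}$ properly extends it. $|\Gamma|$ is the set of propositional variables occurring in $\Gamma$, $Ag(\Gamma)$ the set of agent indices occurring in $\Gamma$, and $\Gamma^\Box$ the set of formulas of the form $\Box A$ belonging to $\Gamma$. A pair $(\Gamma,\Delta)$ is inseparable iff $Ag(\Gamma)\cap Ag(\Delta)=\emptyset$ and there is no $C\in\mathcal{L}^{Ag(\Gamma)\cup Ag(\Delta)}_{|\Gamma|\cap|\Delta|}$ with $\Gamma\vdash C$ and $\Delta\vdash\neg C$. -}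

module Defs where

open import Data.Nat using (ℕ; _≤_)
open import Data.Bool using (Bool; true; false; _∧_; _∨_; not)
open import Data.List using (List; []; _∷_; map; _++_)
open import Data.List.Membership.Propositional using (_∈_)
open import Data.List.Relation.Unary.All using (All)
open import Data.List.Relation.Unary.Unique.Propositional using (Unique)
open import Data.Product using (Σ; _×_; _,_; proj₁; proj₂)
open import Data.Sum using (_⊎_)
open import Data.Empty renaming (⊥ to Empty)
open import Data.Unit using (⊤)
open import Relation.Nullary using (¬_)
open import Relation.Binary.PropositionalEquality using (_≡_)

data Form (V : Set) : Set where
  var  : V → Form V
  _⇒_  : Form V → Form V → Form V
  ⊥'   : Form V
  □    : Form V → Form V
  [_]_ : ℕ → Form V → Form V

infixr 5 _⇒_

AgUpTo : ℕ → ℕ → Set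
AgUpTo n j = (1 ≤ j) × (j ≤ n)

module _ {V : Set} where

  ~_ : Form V → Form V
  ~ A = A ⇒ ⊥'

  ⊤' : Form V
  ⊤' = ⊥' ⇒ ⊥'

  _∧'_ : Form V → Form V → Form V
  A ∧' B = ~ (A ⇒ ~ B)

  ◇ : Form V → Form V
  ◇ A = ~ □ (~ A)

  ⋀ : List (Form V) → Form V
  ⋀ []       = ⊤'
  ⋀ (A ∷ As) = A ∧' ⋀ As

  eval : (Form V → Bool) → Form V → Bool
  eval v (var p)   = v (var p)
  eval v (A ⇒ B)   = not (eval v A) ∨ eval v B
  eval v ⊥'        = false
  eval v (□ A)     = v (□ A)
  eval v ([ j ] A) = v ([ j ] A)

  Tautology : Form V → Set
  Tautology A = (v : Form V → Bool) → eval v A ≡ true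

  data ⊢_ : Form V → Set where
    taut  : ∀ {A} → Tautology A → ⊢ A
    K□    : ∀ {A B} → ⊢ (□ (A ⇒ B) ⇒ □ A ⇒ □ B)
    T□    : ∀ {A} → ⊢ (□ A ⇒ A)
    5□    : ∀ {A} → ⊢ (◇ A ⇒ □ (◇ A))
    Kj    : ∀ {j A B} → ⊢ ([ j ] (A ⇒ B) ⇒ [ j ] A ⇒ [ j ] B)
    Tj    : ∀ {j A} → ⊢ ([ j ] A ⇒ A)
    5j    : ∀ {j A} → ⊢ (~ [ j ] (~ A) ⇒ [ j ] (~ [ j ] (~ A)))
    □j    : ∀ {j A} → ⊢ (□ A ⇒ [ j ] A)
    indep : (js : List (ℕ × Form V)) → Unique (map proj₁ js) →
            ⊢ (⋀ (map (λ jA → ◇ ([ proj₁ jA ] proj₂ jA)) js)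
                 ⇒ ◇ (⋀ (map (λ jA → [ proj₁ jA ] proj₂ jA) js)))
    mp    : ∀ {A B} → ⊢ (A ⇒ B) → ⊢ A → ⊢ B
    nec   : ∀ {A} → ⊢ A → ⊢ □ A

  FSet : Set₁
  FSet = Form V → Set

  _⊆_ : FSet → FSet → Set
  Γ ⊆ Δ = ∀ A → Γ A → Δ A

  _∪_ : FSet → FSet → FSet
  (Γ ∪ Δ) A = Γ A ⊎ Δ A

  _⊢'_ : FSet → Form V → Set
  Γ ⊢' A = Σ (List (Form V)) λ As → All Γ As × (⊢ (⋀ As ⇒ A))

  Consistent : FSet → Set
  Consistent Γ = ¬ (Γ ⊢' ⊥')

  vars : Form V → List V
  vars (var p)   = p ∷ []
  vars (A ⇒ B)   = vars A ++ vars B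
  vars ⊥'        = []
  vars (□ A)     = vars A
  vars ([ j ] A) = vars A

  agents : Form V → List ℕ
  agents (var p)   = []
  agents (A ⇒ B)   = agents A ++ agents B
  agents ⊥'        = []
  agents (□ A)     = agents A
  agents ([ j ] A) = j ∷ agents A

  -- |Γ| and Ag(Γ)
  Vars : FSet → V → Set
  Vars Γ p = Σ (Form V) λ A → Γ A × p ∈ vars A

  Ags : FSet → ℕ → Set
  Ags Γ j = Σ (Form V) λ A → Γ A × j ∈ agents A

  Lang : (ℕ → Set) → (V → Set) → FSet
  Lang Ag' V' A = All Ag' (agents A) × All V' (vars A)

  MaxiCons : (ℕ → Set) → (V → Set) → FSet → Set₁
  MaxiCons Ag' V' Γ =
    (Γ ⊆ Lang Ag' V') × Consistent Γ ×
    ¬ (Σ FSet λ Θ → (Θ ⊆ Lang Ag' V') × Consistent Θ × (Γ ⊆ Θ) ×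
                     Σ (Form V) λ A → Θ A × ¬ Γ A)

  Box : FSet → FSet
  Box Γ A = Σ (Form V) λ B → (A ≡ □ B) × Γ A

  Inseparable : FSet → FSet → Set
  Inseparable Γ Δ =
    ((j : ℕ) → Ags Γ j → Ags Δ j → Empty) ×
    ¬ (Σ (Form V) λ C →
         Lang (λ j → Ags Γ j ⊎ Ags Δ j) (λ p → Vars Γ p × Vars Δ p) C ×
         (Γ ⊢' C) × (Δ ⊢' (~ C)))

  -- {[j1]A1, ..., [jr]Ar} from a list of pairs (j_k, A_k)
  StitSet : List (ℕ × Form V) → FSet
  StitSet js A = Σ (ℕ × Form V) λ jB → jB ∈ js × (A ≡ [ proj₁ jB ] proj₂ jB)

  AllVars : V → Set
  AllVars _ = ⊤

-- Separating formulas can be pushed back from the boxed parts to Γ and Δ themselves.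
-- Since Γ^□ ⊢ □⋀Γ^□, the deduction theorem turns Γ^□ ∪ {[j]A_j} ⊢ C into
-- Γ ⊢ □(⋀[j]A_j → C), and likewise Δ ⊢ □(⋀[i]B_i → ¬C), while the independence
-- axiom gives Δ ⊢ ◇⋀[i]B_i.  Without any [j]A_j the formula □C separates Γ from Δ;
-- with a single one, ◇[j]C does, because j does not occur in Δ and so, again by
-- independence, j cannot prevent ⋀[i]B_i.  The agents of both lists are distinct
-- elements of {1,2,3}, so one of the lists has at most one element; the other case
-- follows by symmetry.
module Submission where

open import Defs
open import Data.Bool using (Bool; true; false; T; not; _∨_)
open import Data.Bool.Properties using (T-≡)
open import Data.Empty using (⊥; ⊥-elim)
open import Data.List using (List; []; _∷_; map; _++_; length; applyUpTo)
open import Data.List.Membership.Propositional using (_∈_; _─_)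
open import Data.List.Membership.Propositional.Properties using (∈-map⁺; ∈-++⁺ˡ; ∈-applyUpTo⁺)
open import Data.List.Properties using (length-++; length-map; length-applyUpTo; length-removeAt′)
open import Data.List.Relation.Binary.Disjoint.Propositional using (Disjoint)
open import Data.List.Relation.Unary.All as All using (All; []; _∷_)
open import Data.List.Relation.Unary.All.Properties using (++⁺; ++⁻; map⁺)
open import Data.List.Relation.Unary.AllPairs using ([]; _∷_)
open import Data.List.Relation.Unary.Any using (here; there; index)
open import Data.List.Relation.Unary.Unique.Propositional using (Unique)
import Data.List.Relation.Unary.Unique.Propositional.Properties as Unique
open import Data.Nat using (ℕ; suc; _+_; _≤_; z≤n; s≤s)
open import Data.Nat.Properties using (≤-refl; ≤-reflexive; ≤-trans; m≤n+m; module ≤-Reasoning)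
open import Data.Product as Prod using (Σ; _×_; _,_; proj₁; proj₂)
open import Data.Sum as Sum using (_⊎_; inj₁; inj₂)
open import Data.Unit using (tt)
open import Function using (_∘_; id; Equivalence)
open import Relation.Binary.PropositionalEquality using (_≢_; refl; subst; sym)
open import Relation.Nullary using (¬_)
open import Relation.Nullary.Decidable using (T?; decidable-stable)

module _ {V : Set} where

  private variable
    A B C : Form V
    As : List (Form V)
    v : Form V → Bool

  -- A record rather than T (eval v A), so that A can be inferred from v ⊨ A.
  record _⊨_ (v : Form V → Bool) (A : Form V) : Set where
    constructor holds
    field truth : T (eval v A)
  open _⊨_

  ⇒-intro : (v ⊨ A → v ⊨ B) → v ⊨ (A ⇒ B)
  ⇒-intro {v} {A} {B} f = holds (imp (eval v A) (eval v B) (truth ∘ f ∘ holds))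
    where
    imp : ∀ a b → (T a → T b) → T (not a ∨ b)
    imp false _ _ = tt
    imp true  _ g = g tt

  ⇒-elim : v ⊨ (A ⇒ B) → v ⊨ A → v ⊨ B
  ⇒-elim (holds t) (holds a) = holds (imp t a)
    where
    imp : ∀ {a b} → T (not a ∨ b) → T a → T b
    imp {true} t _ = t

  ⊭⊥ : ¬ (v ⊨ ⊥')
  ⊭⊥ (holds ())

  ⊨-stable : ¬ ¬ (v ⊨ A) → v ⊨ A
  ⊨-stable {v} {A} ¬¬a = holds (decidable-stable (T? (eval v A)) λ ¬t → ¬¬a (¬t ∘ truth))

  ~-intro : (v ⊨ A → ⊥) → v ⊨ (~ A)
  ~-intro f = ⇒-intro (⊥-elim ∘ f)

  ~-elim : v ⊨ (~ A) → v ⊨ A → ⊥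
  ~-elim ¬a a = ⊭⊥ (⇒-elim ¬a a)

  ∧-intro : v ⊨ A → v ⊨ B → v ⊨ (A ∧' B)
  ∧-intro a b = ~-intro λ a⇒¬b → ~-elim (⇒-elim a⇒¬b a) b

  ∧-elim₁ : v ⊨ (A ∧' B) → v ⊨ A
  ∧-elim₁ ab = ⊨-stable λ ¬a → ~-elim ab (⇒-intro (⊥-elim ∘ ¬a))

  ∧-elim₂ : v ⊨ (A ∧' B) → v ⊨ B
  ∧-elim₂ ab = ⊨-stable λ ¬b → ~-elim ab (⇒-intro λ _ → ~-intro ¬b)

  ⋀-intro : All (v ⊨_) As → v ⊨ ⋀ As
  ⋀-intro []       = ⇒-intro id
  ⋀-intro (a ∷ as) = ∧-intro a (⋀-intro as)

  ⋀-elim : v ⊨ ⋀ As → All (v ⊨_) As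
  ⋀-elim {As = []}    _  = []
  ⋀-elim {As = _ ∷ _} as = ∧-elim₁ as ∷ ⋀-elim (∧-elim₂ as)

  tautology : (∀ v → v ⊨ A) → ⊢ A
  tautology f = taut λ v → Equivalence.to T-≡ (truth (f v))

  ⊢-⋀ : All ⊢_ As → ⊢ ⋀ As
  ⊢-⋀ []       = tautology λ _ → ⋀-intro []
  ⊢-⋀ (p ∷ ps) = mp (mp (tautology λ _ → ⇒-intro λ a → ⇒-intro (∧-intro a)) p) (⊢-⋀ ps)

  ⊢-consequence : All ⊢_ As → (∀ v → All (v ⊨_) As → v ⊨ B) → ⊢ B
  ⊢-consequence ps f = mp (tautology λ v → ⇒-intro (f v ∘ ⋀-elim)) (⊢-⋀ ps)

  ⇒-trans : ⊢ (A ⇒ B) → ⊢ (B ⇒ C) → ⊢ (A ⇒ C)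
  ⇒-trans p q = ⊢-consequence (p ∷ q ∷ []) λ where
    v (p ∷ q ∷ []) → ⇒-intro (⇒-elim q ∘ ⇒-elim p)

  ¬¬-intro : ⊢ (A ⇒ ~ ~ A)
  ¬¬-intro = tautology λ _ → ⇒-intro λ a → ~-intro λ ¬a → ~-elim ¬a a

  module S5 (M : Form V → Form V)
            (axK : ∀ {A B} → ⊢ (M (A ⇒ B) ⇒ M A ⇒ M B))
            (axT : ∀ {A} → ⊢ (M A ⇒ A))
            (ax5 : ∀ {A} → ⊢ (~ M (~ A) ⇒ M (~ M (~ A))))
            (necM : ∀ {A} → ⊢ A → ⊢ M A) where

    ◆ : Form V → Form V
    ◆ A = ~ M (~ A)

    mono : ⊢ (A ⇒ B) → ⊢ (M A ⇒ M B)
    mono p = mp axK (necM p)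

    K-◆ : ⊢ (M (A ⇒ B) ⇒ ◆ A ⇒ ◆ B)
    K-◆ {A} {B} = ⊢-consequence (mono contraposition ∷ axK ∷ []) λ where
        v (c ∷ k ∷ []) → ⇒-intro λ m[a⇒b] → ⇒-intro λ ◆a → ~-intro λ m¬b →
          ~-elim ◆a (⇒-elim (⇒-elim k (⇒-elim c m[a⇒b])) m¬b)
      where
      contraposition : ⊢ ((A ⇒ B) ⇒ ~ B ⇒ ~ A)
      contraposition = tautology λ _ → ⇒-intro λ a⇒b → ⇒-intro λ ¬b → ~-intro (~-elim ¬b ∘ ⇒-elim a⇒b)

    ◆M⇒M : ⊢ (◆ (M A) ⇒ M A)
    ◆M⇒M {A} = ⊢-consequence (ax5 ∷ mono ¬¬-elim ∷ mono ◆¬⇒¬M ∷ []) λ where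
        v (five ∷ elim ∷ step ∷ []) → ⇒-intro λ ◆ma → ⊨-stable λ ¬ma →
          ~-elim ◆ma (⇒-elim step (⇒-elim five (~-intro (¬ma ∘ ⇒-elim elim))))
      where
      ¬¬-elim : ⊢ (~ ~ A ⇒ A)
      ¬¬-elim = tautology λ _ → ⇒-intro λ ¬¬a → ⊨-stable (~-elim ¬¬a ∘ ~-intro)
      ◆¬⇒¬M : ⊢ (◆ (~ A) ⇒ ~ M A)
      ◆¬⇒¬M = ⊢-consequence (mono ¬¬-intro ∷ []) λ where
        v (m ∷ []) → ⇒-intro λ ◆¬a → ~-intro (~-elim ◆¬a ∘ ⇒-elim m)

    four : ⊢ (M A ⇒ M (M A))
    four = ⊢-consequence (axT ∷ ax5 ∷ mono ◆M⇒M ∷ []) λ where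
      v (t ∷ five ∷ b ∷ []) → ⇒-intro λ ma →
        ⇒-elim b (⇒-elim five (~-intro λ m¬ma → ~-elim (⇒-elim t m¬ma) ma))

    lift : ⊢ (M A ⇒ B) → ⊢ (M A ⇒ M B)
    lift p = ⇒-trans four (mono p)

    M-∧ : ⊢ (M A ⇒ M B ⇒ M (A ∧' B))
    M-∧ = ⊢-consequence (mono (tautology λ _ → ⇒-intro λ a → ⇒-intro (∧-intro a)) ∷ axK ∷ []) λ where
      v (m ∷ k ∷ []) → ⇒-intro λ a → ⇒-intro λ b → ⇒-elim (⇒-elim k (⇒-elim m a)) b

  module S5□ = S5 □ K□ T□ 5□ nec
  module S5j (j : ℕ) = S5 ([ j ]_) Kj Tj 5j (λ p → mp □j (nec p))

  private variable
    Γ Δ Θ : FSet {V}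
    Xs : List (Form V)

  ⊢'-mono : Γ ⊆ Θ → Γ ⊢' A → Θ ⊢' A
  ⊢'-mono Γ⊆Θ (As , γ , p) = As , All.map (Γ⊆Θ _) γ , p

  ⊢'-⋀ : All Γ As → Γ ⊢' ⋀ As
  ⊢'-⋀ γ = _ , γ , tautology λ _ → ⇒-intro id

  ⊢'-mp : Γ ⊢' A → ⊢ (A ⇒ B) → Γ ⊢' B
  ⊢'-mp (As , γ , p) q = As , γ , ⇒-trans p q

  ⊢'-mp₂ : Γ ⊢' A → Γ ⊢' B → ⊢ (A ⇒ B ⇒ C) → Γ ⊢' C
  ⊢'-mp₂ (As , γ , p) (Bs , δ , q) r = As ++ Bs , ++⁺ γ δ , ⊢-consequence (p ∷ q ∷ r ∷ []) λ where
    v (p ∷ q ∷ r ∷ []) → ⇒-intro λ ab →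
      let a , b = ++⁻ As (⋀-elim ab) in
      ⇒-elim (⇒-elim r (⇒-elim p (⋀-intro a))) (⇒-elim q (⋀-intro b))

  ∈⇒⊢' : Γ A → Γ ⊢' A
  ∈⇒⊢' a = ⊢'-mp (⊢'-⋀ (a ∷ [])) (tautology λ _ → ⇒-intro ∧-elim₁)

  ⊢'-deduction : (Γ ∪ (_∈ Xs)) ⊢' C → Γ ⊢' (⋀ Xs ⇒ C)
  ⊢'-deduction {Γ = Γ} {Xs = Xs} (As , γx , p) =
    let Bs , γ , split = partition γx in
    Bs , γ , ⊢-consequence (p ∷ []) λ where
        v (p ∷ []) → ⇒-intro λ b → ⇒-intro λ x → ⇒-elim p (⋀-intro (split v (⋀-elim b) (⋀-elim x)))
    where
    partition : ∀ {As} → All (Γ ∪ (_∈ Xs)) As →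
      Σ (List (Form V)) λ Bs → All Γ Bs × (∀ v → All (v ⊨_) Bs → All (v ⊨_) Xs → All (v ⊨_) As)
    partition [] = [] , [] , λ _ _ _ → []
    partition (inj₁ γA ∷ γx) =
      let Bs , γ , split = partition γx in
      _ ∷ Bs , γA ∷ γ , λ { v (a ∷ bs) xs → a ∷ split v bs xs }
    partition (inj₂ A∈Xs ∷ γx) =
      let Bs , γ , split = partition γx in
      Bs , γ , λ v bs xs → All.lookup xs A∈Xs ∷ split v bs xs

  ⋀-boxed : All (Box Γ) As → ⊢ (⋀ As ⇒ □ (⋀ As))
  ⋀-boxed [] = ⊢-consequence (nec (tautology λ _ → ⋀-intro []) ∷ []) λ where
    v (□⊤ ∷ []) → ⇒-intro λ _ → □⊤
  ⋀-boxed ((_ , refl , _) ∷ β) = ⊢-consequence (S5□.four ∷ ⋀-boxed β ∷ S5□.M-∧ ∷ []) λ where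
    v (four ∷ rest ∷ pair ∷ []) → ⇒-intro λ a →
      ⇒-elim (⇒-elim pair (⇒-elim four (∧-elim₁ a))) (⇒-elim rest (∧-elim₂ a))

  Box⊢'⇒⊢'□ : Box Γ ⊢' A → Γ ⊢' □ A
  Box⊢'⇒⊢'□ (As , β , p) = As , All.map (proj₂ ∘ proj₂) β , ⇒-trans (⋀-boxed β) (S5□.mono p)

  stit : ℕ × Form V → Form V
  stit jA = [ proj₁ jA ] proj₂ jA

  private variable
    j : ℕ
    js is : List (ℕ × Form V)

  □∪stit-deduction : (Box Γ ∪ StitSet js) ⊢' C → Γ ⊢' □ (⋀ (map stit js) ⇒ C)
  □∪stit-deduction =
    Box⊢'⇒⊢'□ ∘ ⊢'-deduction ∘ ⊢'-mono λ _ → Sum.map₂ λ { (_ , jA∈js , refl) → ∈-map⁺ stit jA∈js }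

  ◇-joint : All (λ jA → Γ (◇ (stit jA))) js → Unique (map proj₁ js) → Γ ⊢' ◇ (⋀ (map stit js))
  ◇-joint ◇js u = ⊢'-mp (⊢'-⋀ (map⁺ ◇js)) (indep _ u)

  -- Together with the ◇[i]B_i, ◇[j]¬Y would give ◇([j]¬Y ∧ Y) by independence, which T for [j] refutes.
  ◇-joint-unpreventable : All (λ jA → Γ (◇ (stit jA))) js → Unique (map proj₁ js) →
    All (j ≢_) (map proj₁ js) → Γ ⊢' □ (S5j.◆ j (⋀ (map stit js)))
  ◇-joint-unpreventable {js = js} {j = j} ◇js u j∉js = ⊢'-mp (⊢'-⋀ (map⁺ ◇js)) joint⇒□◆
    where
    Y : Form V
    Y = ⋀ (map stit js)
    excluded : ⊢ (~ (([ j ] (~ Y)) ∧' Y))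
    excluded = ⊢-consequence (Tj ∷ []) λ where
      v (t ∷ []) → ~-intro λ c → ~-elim (⇒-elim t (∧-elim₁ c)) (∧-elim₂ c)
    joint⇒□◆ : ⊢ (⋀ (map (◇ ∘ stit) js) ⇒ □ (S5j.◆ j Y))
    joint⇒□◆ = ⊢-consequence (indep ((j , ~ Y) ∷ js) (j∉js ∷ u) ∷ nec excluded ∷ []) λ where
      v (ind ∷ exc ∷ []) → ⇒-intro λ ◇s → ⊨-stable λ ¬□◆ →
        ~-elim (⇒-elim ind (∧-intro (~-intro ¬□◆) ◇s)) exc

  □⇒¬-◇⇒¬□ : ⊢ (□ (A ⇒ ~ C) ⇒ ◇ A ⇒ ~ □ C)
  □⇒¬-◇⇒¬□ = ⊢-consequence (S5□.K-◆ ∷ S5□.mono ¬¬-intro ∷ []) λ where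
    v (k ∷ m ∷ []) → ⇒-intro λ □[a⇒¬c] → ⇒-intro λ ◇a → ~-intro λ □c →
      ~-elim (⇒-elim (⇒-elim k □[a⇒¬c]) ◇a) (⇒-elim m □c)

  □-stit-◇ : ⊢ (□ ([ j ] A ⇒ C) ⇒ ◇ ([ j ] A) ⇒ ◇ ([ j ] C))
  □-stit-◇ {j = j} {A = A} {C = C} = ⇒-trans (S5□.lift stit-K) S5□.K-◆
    where
    stit-K : ⊢ (□ ([ j ] A ⇒ C) ⇒ [ j ] A ⇒ [ j ] C)
    stit-K = ⊢-consequence (□j ∷ Kj ∷ S5j.four j ∷ []) λ where
      v (□⇒j ∷ k ∷ four ∷ []) → ⇒-intro λ □p → ⇒-intro λ a →
        ⇒-elim (⇒-elim k (⇒-elim □⇒j □p)) (⇒-elim four a)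

  □⇒¬-□◆⇒¬◇stit : ⊢ (□ (A ⇒ ~ C) ⇒ □ (S5j.◆ j A) ⇒ ~ ◇ ([ j ] C))
  □⇒¬-□◆⇒¬◇stit {A = A} {C = C} {j = j} =
    ⊢-consequence (S5□.lift (⇒-trans □j (S5j.K-◆ j)) ∷ K□ ∷ S5□.mono ◆¬⇒¬ ∷ []) λ where
        v (l ∷ k ∷ m ∷ []) → ⇒-intro λ □p → ⇒-intro λ □◆a → ~-intro λ ◇c →
          ~-elim ◇c (⇒-elim m (⇒-elim (⇒-elim k (⇒-elim l □p)) □◆a))
    where
    ◆¬⇒¬ : ⊢ (S5j.◆ j (~ C) ⇒ ~ [ j ] C)
    ◆¬⇒¬ = ⊢-consequence (S5j.mono j ¬¬-intro ∷ []) λ where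
      v (m ∷ []) → ⇒-intro λ ◆¬c → ~-intro (~-elim ◆¬c ∘ ⇒-elim m)

  Separates : FSet → FSet → Form V → Set
  Separates Γ Δ C = (Γ ⊢' C) × (Δ ⊢' (~ C))

  separates-□ : All (λ iB → Δ (◇ (stit iB))) is → Unique (map proj₁ is) →
    Separates (Box Γ ∪ StitSet []) (Box Δ ∪ StitSet is) C → Separates Γ Δ (□ C)
  separates-□ ◇is u (Γ⊢C , Δ⊢¬C) =
    ⊢'-mp (□∪stit-deduction Γ⊢C) (S5□.mono (tautology λ _ → ⇒-intro λ ⊤⇒c → ⇒-elim ⊤⇒c (⋀-intro []))) ,
    ⊢'-mp₂ (□∪stit-deduction Δ⊢¬C) (◇-joint ◇is u) □⇒¬-◇⇒¬□

  separates-◇stit : Γ (◇ ([ j ] A)) → All (λ iB → Δ (◇ (stit iB))) is → Unique (map proj₁ is) →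
    All (j ≢_) (map proj₁ is) →
    Separates (Box Γ ∪ StitSet ((j , A) ∷ [])) (Box Δ ∪ StitSet is) C → Separates Γ Δ (◇ ([ j ] C))
  separates-◇stit {j = j} {A = A} {C = C} ◇A ◇is u j∉is (Γ⊢C , Δ⊢¬C) =
    ⊢'-mp₂ (□∪stit-deduction Γ⊢C) (∈⇒⊢' ◇A) (⇒-trans (S5□.mono drop-⊤) □-stit-◇) ,
    ⊢'-mp₂ (□∪stit-deduction Δ⊢¬C) (◇-joint-unpreventable ◇is u j∉is) □⇒¬-□◆⇒¬◇stit
    where
    drop-⊤ : ⊢ ((⋀ (stit (j , A) ∷ []) ⇒ C) ⇒ [ j ] A ⇒ C)
    drop-⊤ = tautology λ _ → ⇒-intro λ p → ⇒-intro λ a → ⇒-elim p (⋀-intro (a ∷ []))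

  private variable
    Ag Ag' : ℕ → Set
    W W' : V → Set

  Lang-mono : ∀ C → (∀ {j} → Ag j → Ag' j) → (∀ {p} → W p → W' p) → Lang Ag W C → Lang Ag' W' C
  Lang-mono _ f g (ags , vs) = All.map f ags , All.map g vs

  Lang-~ : ∀ C → Lang Ag W C → Lang Ag W (~ C)
  Lang-~ _ (ags , vs) = ++⁺ ags [] , ++⁺ vs []

  Lang-◇stit : ∀ C → Ag j → Lang Ag W C → Lang Ag W (◇ ([ j ] C))
  Lang-◇stit {j = j} C aj (ags , vs) = Lang-~ (□ (~ ([ j ] C))) (Lang-~ ([ j ] C) (aj ∷ ags , vs))

  Ags-Lang : Γ ⊆ Lang Ag W → Ags Γ j → Ag j
  Ags-Lang ΓL (A , ΓA , j∈A) = All.lookup (proj₁ (ΓL A ΓA)) j∈A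

  Ags-□∪stit : All (λ jA → Γ (◇ (stit jA))) js → Ags (Box Γ ∪ StitSet js) j → Ags Γ j
  Ags-□∪stit _   (A , inj₁ (_ , _ , ΓA) , j∈A)        = A , ΓA , j∈A
  Ags-□∪stit ◇js (_ , inj₂ (_ , jA∈js , refl) , j∈A) = _ , All.lookup ◇js jA∈js , ∈-++⁺ˡ (∈-++⁺ˡ j∈A)

  Vars-□∪stit : ∀ {p} → All (λ jA → Γ (◇ (stit jA))) js → Vars (Box Γ ∪ StitSet js) p → Vars Γ p
  Vars-□∪stit _   (A , inj₁ (_ , _ , ΓA) , p∈A)        = A , ΓA , p∈A
  Vars-□∪stit ◇js (_ , inj₂ (_ , jA∈js , refl) , p∈A) = _ , All.lookup ◇js jA∈js , ∈-++⁺ˡ (∈-++⁺ˡ p∈A)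

  Inseparable-sym : Inseparable Γ Δ → Inseparable Δ Γ
  Inseparable-sym (disjoint , no-separator) =
    (λ j δ γ → disjoint j γ δ) ,
    λ (C , lang , Δ⊢C , Γ⊢¬C) →
      no-separator (~ C , Lang-~ C (Lang-mono C Sum.swap Prod.swap lang) , Γ⊢¬C , ⊢'-mp Δ⊢C ¬¬-intro)

  □∪stit-interpolant : length js ≤ 1 →
    All (λ jA → Γ (◇ (stit jA))) js → All (λ iB → Δ (◇ (stit iB))) is → Unique (map proj₁ is) →
    All (λ jA → All (proj₁ jA ≢_) (map proj₁ is)) js →
    Separates (Box Γ ∪ StitSet js) (Box Δ ∪ StitSet is) C →
    Σ (Form V) λ D → Separates Γ Δ D × (∀ {Ag W} → All (Ag ∘ proj₁) js → Lang Ag W C → Lang Ag W D)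
  □∪stit-interpolant {js = []} {C = C} _ _ ◇is u _ sep =
    □ C , separates-□ ◇is u sep , λ _ → id
  □∪stit-interpolant {js = _ ∷ []} {C = C} _ (◇A ∷ []) ◇is u (j∉is ∷ []) sep =
    _ , separates-◇stit ◇A ◇is u j∉is sep , λ { (aj ∷ []) → Lang-◇stit C aj }
  □∪stit-interpolant {js = _ ∷ _ ∷ _} (s≤s ())

  Inseparable-□∪stit : length js ≤ 1 →
    All (λ jA → Γ (◇ (stit jA))) js → All (λ iB → Δ (◇ (stit iB))) is →
    All (λ jA → Ags Γ (proj₁ jA)) js → All (λ iB → Ags Δ (proj₁ iB)) is → Unique (map proj₁ is) →
    Inseparable Γ Δ → Inseparable (Box Γ ∪ StitSet js) (Box Δ ∪ StitSet is)
  Inseparable-□∪stit {js = js} {Γ = Γ} {Δ = Δ} {is = is} js≤1 ◇js ◇is agsJ agsI u (disjoint , no-separator) =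
    (λ j γ δ → disjoint j (Ags-□∪stit ◇js γ) (Ags-□∪stit ◇is δ)) ,
    λ (C , lang , sep) →
      let D , sepD , lang-D = □∪stit-interpolant js≤1 ◇js ◇is u distinct sep in
      no-separator (D , lang-D (All.map inj₁ agsJ) (Lang-mono C restrictAgs restrictVars lang) , sepD)
    where
    distinct : All (λ jA → All (proj₁ jA ≢_) (map proj₁ is)) js
    distinct = All.map (λ γ → All.map (λ δ j≡i → disjoint _ γ (subst (Ags Δ) (sym j≡i) δ)) (map⁺ agsI)) agsJ
    restrictAgs : ∀ {j} → Ags (Box Γ ∪ StitSet js) j ⊎ Ags (Box Δ ∪ StitSet is) j → Ags Γ j ⊎ Ags Δ j
    restrictAgs = Sum.map (Ags-□∪stit ◇js) (Ags-□∪stit ◇is)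
    restrictVars : ∀ {p} → Vars (Box Γ ∪ StitSet js) p × Vars (Box Δ ∪ StitSet is) p → Vars Γ p × Vars Δ p
    restrictVars = Prod.map (Vars-□∪stit ◇js) (Vars-□∪stit ◇is)

module _ {a} {A : Set a} where

  private variable
    x y : A
    xs ys : List A

  ∈-─ : (x∈ys : x ∈ ys) → y ∈ ys → x ≢ y → y ∈ ys ─ x∈ys
  ∈-─ (here refl)  (here refl)  x≢y = ⊥-elim (x≢y refl)
  ∈-─ (here refl)  (there y∈ys) _   = y∈ys
  ∈-─ (there _)    (here refl)  _   = here refl
  ∈-─ (there x∈ys) (there y∈ys) x≢y = there (∈-─ x∈ys y∈ys x≢y)

  Unique⇒length≤ : Unique xs → All (_∈ ys) xs → length xs ≤ length ys
  Unique⇒length≤ [] [] = z≤n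
  Unique⇒length≤ {ys = ys} (x≢xs ∷ u) (x∈ys ∷ xs⊆ys) =
    ≤-trans (s≤s (Unique⇒length≤ u (All.zipWith (λ (y∈ys , x≢y) → ∈-─ x∈ys y∈ys x≢y) (xs⊆ys , x≢xs))))
            (≤-reflexive (sym (length-removeAt′ ys (index x∈ys))))

disjoint-agents-one-short : ∀ {n} (xs ys : List ℕ) → n ≤ 3 →
  Unique (xs ++ ys) → All (AgUpTo n) (xs ++ ys) → length xs ≤ 1 ⊎ length ys ≤ 1
disjoint-agents-one-short {n} xs ys n≤3 u ags = split (begin
    length xs + length ys    ≡⟨ length-++ xs ⟨
    length (xs ++ ys)        ≤⟨ Unique⇒length≤ u (All.map AgUpTo⇒∈ ags) ⟩
    length (applyUpTo suc n) ≡⟨ length-applyUpTo suc n ⟩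
    n                        ≤⟨ n≤3 ⟩
    3                        ∎)
  where
  open ≤-Reasoning
  AgUpTo⇒∈ : ∀ {j} → AgUpTo n j → j ∈ applyUpTo suc n
  AgUpTo⇒∈ (s≤s z≤n , j≤n) = ∈-applyUpTo⁺ suc j≤n
  split : ∀ {k l} → k + l ≤ 3 → k ≤ 1 ⊎ l ≤ 1
  split {0} _ = inj₁ z≤n
  split {1} _ = inj₁ ≤-refl
  split {suc (suc k)} {l} (s≤s (s≤s k+l≤1)) = inj₂ (≤-trans (m≤n+m l k) k+l≤1)

stit-lists-one-short : ∀ {V} {Γ Δ : FSet {V}} {n W W'} (js is : List (ℕ × Form V)) → n ≤ 3 →
  Γ ⊆ Lang (AgUpTo n) W → Δ ⊆ Lang (AgUpTo n) W' → (∀ j → Ags Γ j → Ags Δ j → ⊥) →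
  All (λ jA → Ags Γ (proj₁ jA)) js → All (λ iB → Ags Δ (proj₁ iB)) is →
  Unique (map proj₁ js) → Unique (map proj₁ is) → length js ≤ 1 ⊎ length is ≤ 1
stit-lists-one-short js is n≤3 ΓL ΔL disjoint agsJ agsI uJ uI =
  Sum.map (subst (_≤ 1) (length-map proj₁ js)) (subst (_≤ 1) (length-map proj₁ is))
    (disjoint-agents-one-short (map proj₁ js) (map proj₁ is) n≤3 (Unique.++⁺ uJ uI disjoint-ids)
      (++⁺ (All.map (Ags-Lang ΓL) (map⁺ agsJ)) (All.map (Ags-Lang ΔL) (map⁺ agsI))))
  where
  disjoint-ids : Disjoint (map proj₁ js) (map proj₁ is)
  disjoint-ids (j∈js , j∈is) = disjoint _ (All.lookup (map⁺ agsJ) j∈js) (All.lookup (map⁺ agsI) j∈is)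

lemma5 : {V : Set} (n : ℕ) → n ≤ 3 → (Γ Δ : FSet {V}) →
    Γ ⊆ (Lang (AgUpTo n) (AllVars {V})) → _⊆_ {V} Δ (Lang (AgUpTo n) (AllVars {V})) →
    Inseparable Γ Δ →
    MaxiCons (Ags Γ) (Vars Γ) Γ → MaxiCons (Ags Δ) (Vars Δ) Δ →
    (js : List (ℕ × Form V)) → (is : List (ℕ × Form V)) →
    All (λ jA → Γ (◇ ([ proj₁ jA ] proj₂ jA))) js →
    All (λ iB → Δ (◇ ([ proj₁ iB ] proj₂ iB))) is →
    All (λ jA → Ags Γ (proj₁ jA)) js → All (λ iB → Ags Δ (proj₁ iB)) is →
    Unique (map proj₁ js) → Unique (map proj₁ is) →
    Inseparable (Box Γ ∪ StitSet js) (Box Δ ∪ StitSet is)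
lemma5 n n≤3 Γ Δ ΓL ΔL insep _ _ js is ◇js ◇is agsJ agsI uJ uI =
  Sum.[ (λ js≤1 → Inseparable-□∪stit js≤1 ◇js ◇is agsJ agsI uI insep)
      , (λ is≤1 → Inseparable-sym (Inseparable-□∪stit is≤1 ◇is ◇js agsI agsJ uJ (Inseparable-sym insep)))
      ] (stit-lists-one-short js is n≤3 ΓL ΔL (proj₁ insep) agsJ agsI uJ uI)
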